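{- Let $\sigma$ be a feasible schedule for an instance of the split scheduling problem with uniform setup times (as defined in the context), and index the jobs so that their completion times in $\sigma$ satisfy $C_1\le C_2\le\dots\le C_n$. For each machine $i$ and job $j$ let $q_{ij}\ge 0$ be the total amount of processing of job $j$ done on machine $i$ in $\sigma$. Let $\sigma'$ be the schedule obtained from $\sigma$ by rescheduling the job parts on each machine in the order $1,2,\dots,n$; that is, on each machine $i$, starting at time $0$ and without idle time, for $j=1,2,\dots,n$ in this order, if $q_{ij}>0$ the machine performs one setup of length $s$ followed by processing $q_{ij}$ units of job $j$. Let $C'_j$ denote the completion time of job $j$ in $\sigma'$. Then $C'_j\le C_j$ for all $j=1,\dots,n$.
   Context: Split scheduling with uniform setup times: there are $m$ identical parallel machines and $n$ jobs; job $j$ has processing time $p_j\ge 0$, and there is a setup time $s>0$. Each job may be split into parts of arbitrary positive lengths summing to $p_j$, which may be processed on any machines, and parts of the same job may be processed simultaneously on different machines. Before processing a job part, the machine on which it is processed must perform a setup of length $s$; during a setup the machine cannot process or set up anything else, and each machine processes at most one thing at a time. The completion time $C_j$ of job $j$ is the time at which its last part finishes.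
   Formalization: The setup time $s$, the processing times $p_j$, and the start times and lengths of all job parts are rational. -}

module Defs where

open import Data.Nat using (ℕ)
open import Data.Fin using (Fin; _≟_)
open import Data.List using (List; []; _∷_; length; lookup; filter; map; foldr; allFin)
open import Data.Rational using (ℚ; 0ℚ; _+_; _≤_; _<_; _⊔_)
open import Data.Rational.Properties using (_<?_)
open import Data.Product using (_×_)
open import Data.Sum using (_⊎_)
open import Relation.Binary.PropositionalEquality using (_≡_; _≢_)
open import Relation.Nullary using (yes; no)

-- A job part on a machine: the machine starts the setup for this part at
-- time 'start', sets up during [start, start + s), then processes 'len'
-- units of job 'job' during [start + s, start + s + len).
record Part (n : ℕ) : Set where
  constructor part
  field
    job   : Fin n
    start : ℚ
    len   : ℚ
open Part public

Schedule : ℕ → ℕ → Set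
Schedule m n = Fin m → List (Part n)

sumℚ : List ℚ → ℚ
sumℚ = foldr _+_ 0ℚ

maxℚ : List ℚ → ℚ
maxℚ = foldr _⊔_ 0ℚ

endOf : ℚ → {n : ℕ} → Part n → ℚ
endOf s p = start p + s + len p

partsOf : {n : ℕ} → Fin n → List (Part n) → List (Part n)
partsOf j = filter (λ p → job p ≟ j)

q : {m n : ℕ} → Schedule m n → Fin m → Fin n → ℚ
q σ i j = sumℚ (map len (partsOf j (σ i)))

totalProc : {m n : ℕ} → Schedule m n → Fin n → ℚ
totalProc {m} σ j = sumℚ (map (λ i → q σ i j) (allFin m))

-- Completion time of job j: time at which its last part finishes
-- (0 if the job has no parts, which only happens when p_j = 0).
completion : ℚ → {m n : ℕ} → Schedule m n → Fin n → ℚ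
completion s {m} σ j =
  maxℚ (map (λ i → maxℚ (map (endOf s) (partsOf j (σ i)))) (allFin m))

record Feasible (s : ℚ) {m n : ℕ} (p : Fin n → ℚ) (σ : Schedule m n) : Set where
  field
    start-nonneg : ∀ i (k : Fin (length (σ i))) → 0ℚ ≤ start (lookup (σ i) k)
    len-pos      : ∀ i (k : Fin (length (σ i))) → 0ℚ < len (lookup (σ i) k)
    disjoint     : ∀ i (k k' : Fin (length (σ i))) → k ≢ k' →
                   (endOf s (lookup (σ i) k) ≤ start (lookup (σ i) k'))
                   ⊎ (endOf s (lookup (σ i) k') ≤ start (lookup (σ i) k))
    total        : ∀ j → totalProc σ j ≡ p j

reorderMachine : ℚ → {n : ℕ} → (Fin n → ℚ) → ℚ → List (Fin n) → List (Part n)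
reorderMachine s qi t [] = []
reorderMachine s qi t (j ∷ js) with 0ℚ <? qi j
... | yes _ = part j t (qi j) ∷ reorderMachine s qi (t + s + qi j) js
... | no  _ = reorderMachine s qi t js

reorder : ℚ → {m n : ℕ} → Schedule m n → Schedule m n
reorder s {m} {n} σ i = reorderMachine s (q σ i) 0ℚ (allFin n)

-- Fix a machine i and a job j. In σ' the parts of j on machine i are finished once every
-- job k ≤ j with q_ik > 0 has received one setup and its q_ik units, i.e. by time
-- Σ_{k ≤ j, q_ik > 0} (s + q_ik). In σ each such job k has at least one part on machine i,
-- so this is at most the total setup-plus-processing time of the parts of jobs k ≤ j on
-- machine i in σ. Those parts occupy disjoint subintervals of [0, max_{k ≤ j} C_k] = [0, C_j],
-- hence their total length is at most C_j.
module Submission where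

open import Defs
open import Data.Nat using (ℕ; suc; s≤s) renaming (_≤_ to _≤ℕ_)
import Data.Nat.Properties as ℕ
open import Data.Fin using (Fin) renaming (_≤_ to _≤ᶠ_; _<_ to _<ᶠ_)
import Data.Fin as Fin
import Data.Fin.Properties as Fin
open import Data.Rational using (ℚ; 0ℚ; _≤_; _<_; _+_)
open import Data.Rational.Properties
open import Algebra.Bundles using (CommutativeMonoid)
open import Data.Rational.Solver using (module +-*-Solver)
open import Data.List using (List; []; _∷_; length; lookup; filter; map; allFin)
import Data.List.Properties as List
open import Data.List.Membership.Propositional using (_∈_)
open import Data.List.Membership.Propositional.Properties using (∈-filter⁺; ∈-filter⁻; ∈-allFin)
open import Data.List.Relation.Unary.Any using (here; there)
open import Data.List.Relation.Unary.All as All using (All; []; _∷_)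
import Data.List.Relation.Unary.All.Properties as All
open import Data.List.Relation.Unary.AllPairs using (AllPairs; []; _∷_)
import Data.List.Relation.Unary.AllPairs.Properties as AllPairs
open import Data.List.Relation.Unary.Unique.Propositional using (Unique)
import Data.List.Relation.Unary.Unique.Propositional.Properties as Unique
open import Data.Product using (_,_)
open import Data.Sum using (_⊎_; inj₁; inj₂)
open import Data.Empty using (⊥-elim)
open import Function using (_∘_; id)
open import Relation.Binary.PropositionalEquality
open import Relation.Nullary using (yes; no; ¬?; _×-dec_)
open import Relation.Unary using (Decidable)

open +-*-Solver using (solve; _:+_; _:=_)
open import Algebra.Properties.CommutativeSemigroup
  (CommutativeMonoid.commutativeSemigroup +-0-commutativeMonoid) using (x∙yz≈y∙xz)

private
  variable
    A : Set
    n : ℕ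

All-fromLookup : {P : A → Set} (xs : List A) → (∀ k → P (lookup xs k)) → All P xs
All-fromLookup []       h = []
All-fromLookup (x ∷ xs) h = h Fin.zero ∷ All-fromLookup xs (h ∘ Fin.suc)

AllPairs-fromLookup : {R : A → A → Set} (xs : List A) →
  (∀ k k' → k ≢ k' → R (lookup xs k) (lookup xs k')) → AllPairs R xs
AllPairs-fromLookup []       h = []
AllPairs-fromLookup (x ∷ xs) h =
  All-fromLookup xs (λ k → h Fin.zero (Fin.suc k) (λ ())) ∷
  AllPairs-fromLookup xs (λ k k' k≢k' → h (Fin.suc k) (Fin.suc k') (k≢k' ∘ Fin.suc-injective))

maxℚ-map-upper : (f : A → ℚ) {xs : List A} {x : A} → x ∈ xs → f x ≤ maxℚ (map f xs)
maxℚ-map-upper f (here refl) = p≤p⊔q _ _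
maxℚ-map-upper f {y ∷ _} (there x∈) = p≤q⇒p≤r⊔q (f y) (maxℚ-map-upper f x∈)

maxℚ-map-least : (f : A → ℚ) (xs : List A) {c : ℚ} → 0ℚ ≤ c →
                 (∀ {x} → x ∈ xs → f x ≤ c) → maxℚ (map f xs) ≤ c
maxℚ-map-least f []       0≤c h = 0≤c
maxℚ-map-least f (x ∷ xs) 0≤c h = ⊔-lub (h (here refl)) (maxℚ-map-least f xs 0≤c (h ∘ there))

maxℚ-nonneg : (xs : List ℚ) → 0ℚ ≤ maxℚ xs
maxℚ-nonneg []       = ≤-refl
maxℚ-nonneg (x ∷ xs) = p≤q⇒p≤r⊔q x (maxℚ-nonneg xs)

≤-+-nonnegˡ : {p q : ℚ} → 0ℚ ≤ p → q ≤ p + q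
≤-+-nonnegˡ {p} {q} 0≤p = subst (_≤ p + q) (+-identityˡ q) (+-monoˡ-≤ q 0≤p)

+-nonneg : {p q : ℚ} → 0ℚ ≤ p → 0ℚ ≤ q → 0ℚ ≤ p + q
+-nonneg {p} {q} 0≤p 0≤q = subst (_≤ p + q) (+-identityʳ 0ℚ) (+-mono-≤ 0≤p 0≤q)

sumBy : (A → ℚ) → List A → ℚ
sumBy g xs = sumℚ (map g xs)

sumBy-nonneg : {g : A → ℚ} {xs : List A} → All (λ x → 0ℚ ≤ g x) xs → 0ℚ ≤ sumBy g xs
sumBy-nonneg []            = ≤-refl
sumBy-nonneg (0≤gx ∷ 0≤gxs) = +-nonneg 0≤gx (sumBy-nonneg 0≤gxs)

sumBy-mono : {f g : A → ℚ} → (∀ x → f x ≤ g x) → (xs : List A) → sumBy f xs ≤ sumBy g xs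
sumBy-mono f≤g []       = ≤-refl
sumBy-mono f≤g (x ∷ xs) = +-mono-≤ (f≤g x) (sumBy-mono f≤g xs)

sumBy-partition : {P : A → Set} (P? : Decidable P) (g : A → ℚ) (xs : List A) →
  sumBy g xs ≡ sumBy g (filter P? xs) + sumBy g (filter (¬? ∘ P?) xs)
sumBy-partition P? g [] = sym (+-identityʳ 0ℚ)
sumBy-partition P? g (x ∷ xs) with P? x
... | yes _ = trans (cong (g x +_) (sumBy-partition P? g xs)) (sym (+-assoc (g x) (sumBy g (filter P? xs)) _))
... | no  _ = trans (cong (g x +_) (sumBy-partition P? g xs))
                (x∙yz≈y∙xz (g x) (sumBy g (filter P? xs)) _)

duration : ℚ → Part n → ℚ
duration s x = s + len x

Disjoint : ℚ → Part n → Part n → Set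
Disjoint s x y = endOf s x ≤ start y ⊎ endOf s y ≤ start x

-- Splitting the rest of the list into the parts before and after the head x, the two
-- sublists fit into [a, start x] and [endOf x, T]; the fuel N bounds the length.
packing : (s : ℚ) (N : ℕ) (xs : List (Part n)) → length xs ≤ℕ N →
  AllPairs (Disjoint s) xs → {a T : ℚ} → a ≤ T →
  All (λ x → a ≤ start x) xs → All (λ x → endOf s x ≤ T) xs →
  a + sumBy (duration s) xs ≤ T
packing s N [] _ _ {a} {T} a≤T _ _ = subst (_≤ T) (sym (+-identityʳ a)) a≤T
packing s (suc N) (x ∷ xs) (s≤s |xs|≤N) (x⊥xs ∷ xs-disj) {a} {T} a≤T (a≤x ∷ a≤xs) (x≤T ∷ xs≤T) =
  begin
    a + (dur x + sumBy dur xs)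
      ≡⟨ cong (λ z → a + (dur x + z)) (sumBy-partition before? dur xs) ⟩
    a + (dur x + (sumBy dur before + sumBy dur after))
      ≡⟨ solve 4 (λ a d b c → a :+ (d :+ (b :+ c)) := a :+ b :+ d :+ c) refl
                 a (dur x) (sumBy dur before) (sumBy dur after) ⟩
    a + sumBy dur before + dur x + sumBy dur after
      ≤⟨ +-monoˡ-≤ (sumBy dur after) (+-monoˡ-≤ (dur x) before-fits) ⟩
    start x + dur x + sumBy dur after
      ≡⟨ cong (_+ sumBy dur after) (sym (+-assoc (start x) s (len x))) ⟩
    endOf s x + sumBy dur after
      ≤⟨ after-fits ⟩
    T ∎
  where
    open ≤-Reasoning hiding (start)
    dur = duration s
    before? : Decidable (λ y → endOf s y ≤ start x)
    before? y = endOf s y ≤? start x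
    before = filter before? xs
    after = filter (¬? ∘ before?) xs
    before-fits : a + sumBy dur before ≤ start x
    before-fits = packing s N before (ℕ.≤-trans (List.length-filter before? xs) |xs|≤N)
      (AllPairs.filter⁺ before? xs-disj) a≤x
      (All.filter⁺ before? a≤xs) (All.all-filter before? xs)
    after-x : All (λ y → endOf s x ≤ start y) after
    after-x = All.zipWith (λ { (inj₁ x≤y , _) → x≤y ; (inj₂ y≤x , y≰x) → ⊥-elim (y≰x y≤x) })
      (All.filter⁺ (¬? ∘ before?) x⊥xs , All.all-filter (¬? ∘ before?) xs)
    after-fits : endOf s x + sumBy dur after ≤ T
    after-fits = packing s N after (ℕ.≤-trans (List.length-filter (¬? ∘ before?) xs) |xs|≤N)
      (AllPairs.filter⁺ (¬? ∘ before?) xs-disj) x≤T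
      after-x (All.filter⁺ (¬? ∘ before?) xs≤T)

module _ {n : ℕ} (s : ℚ) (qi : Fin n → ℚ) where

  block : Fin n → ℚ
  block k with 0ℚ <? qi k
  ... | yes _ = s + qi k
  ... | no  _ = 0ℚ

  block-pos : ∀ k → 0ℚ < qi k → block k ≡ s + qi k
  block-pos k 0<qk with 0ℚ <? qi k
  ... | yes _    = refl
  ... | no  0≮qk = ⊥-elim (0≮qk 0<qk)

  block-nonneg : 0ℚ ≤ s → ∀ k → 0ℚ ≤ block k
  block-nonneg 0≤s k with 0ℚ <? qi k
  ... | yes 0<qk = +-nonneg 0≤s (<⇒≤ 0<qk)
  ... | no  _    = ≤-refl

  reorderMachine-jobs : ∀ {t} js {x} → x ∈ reorderMachine s qi t js → job x ∈ js
  reorderMachine-jobs (k ∷ ks) x∈ with 0ℚ <? qi k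
  reorderMachine-jobs (k ∷ ks) (here refl) | yes _ = here refl
  reorderMachine-jobs (k ∷ ks) (there x∈)  | yes _ = there (reorderMachine-jobs ks x∈)
  reorderMachine-jobs (k ∷ ks) x∈          | no  _ = there (reorderMachine-jobs ks x∈)

  reorderMachine-end≤sumBy-block : 0ℚ ≤ s → ∀ t js → AllPairs _<ᶠ_ js → ∀ {x} →
    x ∈ reorderMachine s qi t js → endOf s x ≤ t + sumBy block (filter (Fin._≤? job x) js)
  reorderMachine-end≤sumBy-block 0≤s t (k ∷ ks) (k<ks ∷ ks↑) x∈ with 0ℚ <? qi k
  reorderMachine-end≤sumBy-block 0≤s t (k ∷ ks) (k<ks ∷ ks↑) (here refl) | yes 0<qk =
    begin
      t + s + qi k
        ≡⟨ trans (+-assoc t s (qi k)) (cong (t +_) (sym (block-pos k 0<qk))) ⟩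
      t + block k
        ≤⟨ +-monoʳ-≤ t (subst (_≤ block k + rest) (+-identityʳ (block k)) (+-monoʳ-≤ (block k) rest≥0)) ⟩
      t + (block k + rest)
        ≡⟨ cong (λ ks' → t + sumBy block ks') (sym (List.filter-accept (Fin._≤? k) (Fin.≤-refl {x = k}))) ⟩
      t + sumBy block (filter (Fin._≤? k) (k ∷ ks)) ∎
    where
      open ≤-Reasoning hiding (start)
      rest = sumBy block (filter (Fin._≤? k) ks)
      rest≥0 : 0ℚ ≤ rest
      rest≥0 = sumBy-nonneg {xs = filter (Fin._≤? k) ks} (All.tabulate (λ {k'} _ → block-nonneg 0≤s k'))
  reorderMachine-end≤sumBy-block 0≤s t (k ∷ ks) (k<ks ∷ ks↑) {x} (there x∈) | yes 0<qk =
    begin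
      endOf s x
        ≤⟨ reorderMachine-end≤sumBy-block 0≤s (t + s + qi k) ks ks↑ x∈ ⟩
      t + s + qi k + rest
        ≡⟨ solve 4 (λ t s q r → t :+ s :+ q :+ r := t :+ (s :+ q :+ r)) refl t s (qi k) rest ⟩
      t + (s + qi k + rest)
        ≡⟨ cong (λ b → t + (b + rest)) (sym (block-pos k 0<qk)) ⟩
      t + (block k + rest)
        ≡⟨ cong (λ ks' → t + sumBy block ks') (sym (List.filter-accept (Fin._≤? job x) k≤x)) ⟩
      t + sumBy block (filter (Fin._≤? job x) (k ∷ ks)) ∎
    where
      open ≤-Reasoning hiding (start)
      rest = sumBy block (filter (Fin._≤? job x) ks)
      k≤x = ℕ.<⇒≤ (All.lookup k<ks (reorderMachine-jobs ks x∈))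
  reorderMachine-end≤sumBy-block 0≤s t (k ∷ ks) (k<ks ∷ ks↑) {x} x∈ | no _ =
    begin
      endOf s x
        ≤⟨ reorderMachine-end≤sumBy-block 0≤s t ks ks↑ x∈ ⟩
      t + sumBy block (filter (Fin._≤? job x) ks)
        ≤⟨ +-monoʳ-≤ t (sumBy-block-filter-cons (Fin._≤? job x)) ⟩
      t + sumBy block (filter (Fin._≤? job x) (k ∷ ks)) ∎
    where
      open ≤-Reasoning hiding (start)
      sumBy-block-filter-cons : {P : Fin n → Set} (P? : Decidable P) →
        sumBy block (filter P? ks) ≤ sumBy block (filter P? (k ∷ ks))
      sumBy-block-filter-cons P? with P? k
      ... | yes _ = ≤-+-nonnegˡ (block-nonneg 0≤s k)
      ... | no  _ = ≤-refl

-- q σ i is definitionally work (σ i), which lets lemma1 apply the machine lemmas to reorder s σ.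
work : List (Part n) → Fin n → ℚ
work xs k = sumBy len (partsOf k xs)

load : (s : ℚ) {P : Fin n → Set} → Decidable P → List (Part n) → ℚ
load s P? xs = sumBy (duration s) (filter (P? ∘ job) xs)

load-nonneg : {s : ℚ} → 0ℚ ≤ s → {P : Fin n → Set} (P? : Decidable P) {xs : List (Part n)} →
  All (λ x → 0ℚ ≤ len x) xs → 0ℚ ≤ load s P? xs
load-nonneg 0≤s P? 0≤len = sumBy-nonneg (All.map (+-nonneg 0≤s) (All.filter⁺ (P? ∘ job) 0≤len))

load-split : (s : ℚ) {P : Fin n → Set} (P? : Decidable P) {k : Fin n} → P k → (xs : List (Part n)) →
  load s P? xs ≡ load s (Fin._≟ k) xs + load s (λ j → ¬? (j Fin.≟ k) ×-dec P? j) xs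
load-split s P? Pk [] = sym (+-identityʳ 0ℚ)
load-split s P? {k} Pk (x ∷ xs) with P? (job x) | job x Fin.≟ k
... | yes _  | yes refl = trans (cong (duration s x +_) (load-split s P? Pk xs))
                            (sym (+-assoc (duration s x) (load s (Fin._≟ k) xs) _))
... | yes _  | no  _    = trans (cong (duration s x +_) (load-split s P? Pk xs))
                            (x∙yz≈y∙xz (duration s x) (load s (Fin._≟ k) xs) _)
... | no ¬Pk | yes refl = ⊥-elim (¬Pk Pk)
... | no  _  | no  _    = load-split s P? Pk xs

setup+sumBy-len≤sumBy-duration : {s : ℚ} → 0ℚ ≤ s → (xs : List (Part n)) →
  0ℚ < sumBy len xs → s + sumBy len xs ≤ sumBy (duration s) xs
setup+sumBy-len≤sumBy-duration 0≤s [] 0<0 = ⊥-elim (<-irrefl refl 0<0)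
setup+sumBy-len≤sumBy-duration {s = s} 0≤s (x ∷ xs) _ =
  begin
    s + (len x + sumBy len xs)     ≡⟨ sym (+-assoc s (len x) (sumBy len xs)) ⟩
    duration s x + sumBy len xs    ≤⟨ +-monoʳ-≤ (duration s x) (sumBy-mono (λ y → ≤-+-nonnegˡ 0≤s) xs) ⟩
    sumBy (duration s) (x ∷ xs)    ∎
  where open ≤-Reasoning hiding (start)

-- A job with positive work on a machine has at least one part there, paying a setup.
block-work≤load : {s : ℚ} → 0ℚ ≤ s → {xs : List (Part n)} → All (λ x → 0ℚ ≤ len x) xs →
  ∀ k → block s (work xs) k ≤ load s (Fin._≟ k) xs
block-work≤load 0≤s {xs} 0≤len k with 0ℚ <? work xs k
... | yes 0<w = setup+sumBy-len≤sumBy-duration 0≤s (partsOf k xs) 0<w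
... | no  _   = load-nonneg 0≤s (Fin._≟ k) 0≤len

sumBy-block-work≤load : {s : ℚ} → 0ℚ ≤ s → {xs : List (Part n)} → All (λ x → 0ℚ ≤ len x) xs →
  {P : Fin n → Set} (P? : Decidable P) (ks : List (Fin n)) → Unique ks → All P ks →
  sumBy (block s (work xs)) ks ≤ load s P? xs
sumBy-block-work≤load 0≤s 0≤len P? [] _ _ = load-nonneg 0≤s P? 0≤len
sumBy-block-work≤load {s = s} 0≤s {xs} 0≤len P? (k ∷ ks) (k∉ks ∷ ks-unique) (Pk ∷ Pks) =
  begin
    block s (work xs) k + sumBy (block s (work xs)) ks
      ≤⟨ +-mono-≤ (block-work≤load 0≤s 0≤len k)
                  (sumBy-block-work≤load 0≤s 0≤len P?∖k ks ks-unique
                    (All.zipWith (λ (k≢j , Pj) → k≢j ∘ sym , Pj) (k∉ks , Pks))) ⟩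
    load s (Fin._≟ k) xs + load s P?∖k xs
      ≡⟨ sym (load-split s P? Pk xs) ⟩
    load s P? xs ∎
  where
    open ≤-Reasoning hiding (start)
    P?∖k = λ j → ¬? (j Fin.≟ k) ×-dec P? j

reorderMachine-end≤ : {s : ℚ} → 0ℚ ≤ s → (xs : List (Part n)) →
  All (λ x → 0ℚ ≤ start x) xs → All (λ x → 0ℚ ≤ len x) xs → AllPairs (Disjoint s) xs →
  {j : Fin n} {C : ℚ} → 0ℚ ≤ C → All (λ x → job x ≤ᶠ j → endOf s x ≤ C) xs →
  ∀ {y} → y ∈ partsOf j (reorderMachine s (work xs) 0ℚ (allFin n)) → endOf s y ≤ C
reorderMachine-end≤ {n = n} {s} 0≤s xs 0≤start 0≤len xs-disjoint {j} {C} 0≤C ≤j⇒≤C {y} y∈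
  with ∈-filter⁻ (λ x → job x Fin.≟ j) y∈
... | y∈reordered , refl =
  begin
    endOf s y
      ≤⟨ reorderMachine-end≤sumBy-block s (work xs) 0≤s 0ℚ (allFin n) (AllPairs.tabulate⁺-< id) y∈reordered ⟩
    0ℚ + sumBy (block s (work xs)) earlier
      ≡⟨ +-identityˡ _ ⟩
    sumBy (block s (work xs)) earlier
      ≤⟨ sumBy-block-work≤load 0≤s 0≤len (Fin._≤? job y) earlier
           (Unique.filter⁺ (Fin._≤? job y) (Unique.allFin⁺ n)) (All.all-filter (Fin._≤? job y) (allFin n)) ⟩
    load s (Fin._≤? job y) xs
      ≡⟨ +-identityˡ _ ⟨
    0ℚ + sumBy (duration s) before
      ≤⟨ packing s (length before) before ℕ.≤-refl (AllPairs.filter⁺ ≤y? xs-disjoint) 0≤C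
           (All.filter⁺ ≤y? 0≤start) (All.zipWith (λ (≤C , ≤y) → ≤C ≤y) (All.filter⁺ ≤y? ≤j⇒≤C , All.all-filter ≤y? xs)) ⟩
    C ∎
  where
    open ≤-Reasoning hiding (start)
    earlier = filter (Fin._≤? job y) (allFin n)
    ≤y? = λ (x : Part _) → job x Fin.≤? job y
    before = filter ≤y? xs

endOf≤completion : (s : ℚ) {m : ℕ} (σ : Schedule m n) (i : Fin m) {x : Part n} →
  x ∈ σ i → endOf s x ≤ completion s σ (job x)
endOf≤completion s {m} σ i {x} x∈ =
  ≤-trans (maxℚ-map-upper (endOf s) (∈-filter⁺ (λ y → job y Fin.≟ job x) x∈ refl))
          (maxℚ-map-upper (λ i' → maxℚ (map (endOf s) (partsOf (job x) (σ i')))) (∈-allFin i))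

lemma1 : (m n : ℕ) (s : ℚ) (p : Fin n → ℚ) (σ : Schedule m n) →
         0ℚ < s →
         (∀ j → 0ℚ ≤ p j) →
         Feasible s p σ →
         (∀ (j k : Fin n) → j ≤ᶠ k → completion s σ j ≤ completion s σ k) →
         ∀ (j : Fin n) → completion s (reorder s σ) j ≤ completion s σ j
lemma1 m n s p σ 0<s _ feasible completion-mono j =
  maxℚ-map-least _ (allFin m) 0≤Cj λ {i} _ →
    maxℚ-map-least (endOf s) _ 0≤Cj
      (reorderMachine-end≤ (<⇒≤ 0<s) (σ i)
        (All-fromLookup (σ i) (start-nonneg i))
        (All-fromLookup (σ i) (<⇒≤ ∘ len-pos i))
        (AllPairs-fromLookup (σ i) (disjoint i))
        0≤Cj
        (All.tabulate λ {x} x∈ x≤j → ≤-trans (endOf≤completion s σ i x∈) (completion-mono (job x) j x≤j)))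
  where
    open Feasible feasible
    0≤Cj : 0ℚ ≤ completion s σ j
    0≤Cj = maxℚ-nonneg (map (λ i → maxℚ (map (endOf s) (partsOf j (σ i)))) (allFin m))
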